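{- Let $P$ be a finite ranked poset of rank $2$. Then \[ \sum_{v \in P_0} R_0(v) - \sum_{e \in P_1} R_1(e) + \sum_{\sigma \in P_2} R_2(\sigma) = \chi_{gr}(P). \]
   Context: For a poset $P$, write $a \prec b$ if $b$ covers $a$. A rank function for $P$ is a function $\rho: P \to \{0,1,\dots,r\}$ (some $r \in \mathbb{N}\cup\{0\}$) such that $\rho(a)=0$ for every minimal element $a$, and $\rho(b)=\rho(a)+1$ whenever $a \prec b$. $P$ is ranked if it has a rank function (which is then unique); its rank is the smallest possible such $r$. For $i \in \{0,\dots,r\}$ let $P_i=\{x\in P \mid \rho(x)=i\}$ and $p_i=|P_i|$. The ranked Euler characteristic of a finite ranked poset of rank $r$ is $\chi_{gr}(P)=\sum_{i=0}^r(-1)^i p_i$. For $x\in P_i$ define $A_i(x)=|\{y\in P_{i+1}\mid x\prec y\}|$, $B_i(x)=|\{z\in P_{i-1}\mid z\prec x\}|$, $U_i(x)=\sum_{y\succ x}B_{i+1}(y)$, $D_i(x)=\sum_{z\prec x}A_{i-1}(z)$ (empty sums are $0$). For a ranked poset of rank $2$ define, for $v\in P_0$, $e\in P_1$, $\sigma\in P_2$: $R_0(v)=1+\tfrac32A_0(v)-A_0(v)^2$, $R_1(e)=1+6A_1(e)+\tfrac32B_1(e)-U_1(e)-D_1(e)$, $R_2(\sigma)=1+6B_2(\sigma)-B_2(\sigma)^2$. -}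

module Defs where

open import Level using (0ℓ)
open import Data.Nat as ℕ using (ℕ; zero; suc; _≤_; _∸_)
open import Data.Integer using (+_)
open import Data.Rational as ℚ using (ℚ; 0ℚ; 1ℚ; _+_; _-_; _*_; -_)
open import Data.Fin using (Fin)
import Data.Fin as Fin
open import Data.Fin.Properties using (all?)
open import Data.Product using (_×_; _,_)
open import Relation.Nullary using (¬_; Dec; yes; no)
open import Relation.Nullary.Decidable using (_×-dec_; ¬?)
open import Relation.Binary.PropositionalEquality using (_≡_)
open import Relation.Binary.Structures using (IsDecPartialOrder)
open import Relation.Unary using (Pred; Decidable)

record FinPoset (n : ℕ) : Set₁ where
  field
    _⊑_ : Fin n → Fin n → Set
    isDecPartialOrder : IsDecPartialOrder _≡_ _⊑_
  open IsDecPartialOrder isDecPartialOrder public using () renaming (_≤?_ to _⊑?_)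

module _ {n : ℕ} (P : FinPoset n) where
  open FinPoset P

  _⊏_ : Fin n → Fin n → Set
  a ⊏ b = a ⊑ b × ¬ (a ≡ b)

  _⊏?_ : (a b : Fin n) → Dec (a ⊏ b)
  a ⊏? b = (a ⊑? b) ×-dec ¬? (a Fin.≟ b)

  _⋖_ : Fin n → Fin n → Set
  a ⋖ b = a ⊏ b × (∀ c → ¬ (a ⊏ c × c ⊏ b))

  _⋖?_ : (a b : Fin n) → Dec (a ⋖ b)
  a ⋖? b = (a ⊏? b) ×-dec all? (λ c → ¬? ((a ⊏? c) ×-dec (c ⊏? b)))

  Minimal : Fin n → Set
  Minimal a = ∀ b → b ⊑ a → b ≡ a

  record IsRankFunction (ρ : Fin n → ℕ) : Set where
    field
      minimal⇒0 : ∀ a → Minimal a → ρ a ≡ 0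
      cover⇒suc : ∀ a b → a ⋖ b → ρ b ≡ suc (ρ a)

  HasRank : (ρ : Fin n → ℕ) → ℕ → Set
  HasRank ρ r = (∀ x → ρ x ≤ r) × (∀ s → (∀ x → ρ x ≤ s) → r ≤ s)

sumFin : ∀ {n} → (Fin n → ℚ) → ℚ
sumFin {zero} f = 0ℚ
sumFin {suc n} f = f Fin.zero + sumFin (λ i → f (Fin.suc i))

sumWhere : ∀ {n} {Q : Pred (Fin n) 0ℓ} → Decidable Q → (Fin n → ℚ) → ℚ
sumWhere Q? f = sumFin (λ i → sel (Q? i) (f i))
  where
  sel : ∀ {A : Set} → Dec A → ℚ → ℚ
  sel (yes _) q = q
  sel (no _) q = 0ℚ

count : ∀ {n} {Q : Pred (Fin n) 0ℓ} → Decidable Q → ℚ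
count Q? = sumWhere Q? (λ _ → 1ℚ)

ℕtoℚ : ℕ → ℚ
ℕtoℚ k = + k ℚ./ 1

module Ranked {n : ℕ} (P : FinPoset n) (ρ : Fin n → ℕ) where

  p : ℕ → ℚ
  p i = count (λ x → ρ x ℕ.≟ i)

  χgr : ℕ → ℚ
  χgr r = go r
    where
    sign : ℕ → ℚ → ℚ
    sign zero q = q
    sign (suc i) q = - sign i q
    go : ℕ → ℚ
    go zero = p 0
    go (suc i) = go i + sign (suc i) (p (suc i))

  A : ℕ → Fin n → ℚ
  A i x = count (λ y → (ρ y ℕ.≟ suc i) ×-dec (_⋖?_ P x y))

  -- B_i(x) = |{ z ∈ P_{i-1} | z ⋖ x }|  (P_{-1} = ∅)
  B : ℕ → Fin n → ℚ
  B i x = count (λ z → (suc (ρ z) ℕ.≟ i) ×-dec (_⋖?_ P z x))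

  U : ℕ → Fin n → ℚ
  U i x = sumWhere (λ y → _⋖?_ P x y) (λ y → B (suc i) y)

  -- D_i(x) = Σ_{z ≺ x} A_{i-1}(z)   (used only for i ≥ 1)
  D : ℕ → Fin n → ℚ
  D i x = sumWhere (λ z → _⋖?_ P z x) (λ z → A (i ∸ 1) z)

  3/2 : ℚ
  3/2 = + 3 ℚ./ 2

  R₀ : Fin n → ℚ
  R₀ v = 1ℚ + 3/2 * A 0 v - A 0 v * A 0 v

  R₁ : Fin n → ℚ
  R₁ e = 1ℚ + ℕtoℚ 6 * A 1 e + 3/2 * B 1 e - U 1 e - D 1 e

  R₂ : Fin n → ℚ
  R₂ σ = 1ℚ + ℕtoℚ 6 * B 2 σ - B 2 σ * B 2 σ

  LHS : ℚ
  LHS = sumWhere (λ v → ρ v ℕ.≟ 0) R₀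
      - sumWhere (λ e → ρ e ℕ.≟ 1) R₁
      + sumWhere (λ σ → ρ σ ℕ.≟ 2) R₂

-- Every term of the left-hand side except the constants 1 cancels by double counting cover
-- pairs between consecutive ranks: Σ_{P₀} A₀ = Σ_{P₁} B₁ and Σ_{P₁} A₁ = Σ_{P₂} B₂ count the
-- covers from rank 0 to 1 and from rank 1 to 2, while Σ_{P₁} D₁ = Σ_{P₀} A₀² and
-- Σ_{P₁} U₁ = Σ_{P₂} B₂² count the pairs of covers sharing their lower, resp. upper, element.
-- What is left is p₀ − p₁ + p₂.
module Submission where

open import Defs
open import Data.Nat using (ℕ)
open import Data.Fin using (Fin)
open import Relation.Binary.PropositionalEquality using (_≡_)

import Data.Nat as ℕ
open import Data.Nat.Properties using (suc-injective)
open import Data.Fin using (zero; suc)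
open import Data.Product using (_×_; _,_; proj₂)
open import Data.Rational using (ℚ; _+_; _*_; _-_; -_; 0ℚ; 1ℚ)
open import Data.Rational.Properties
  using (*-identityˡ; *-identityʳ; *-zeroˡ; *-zeroʳ; *-comm; *-assoc; *-distribˡ-+; neg-distribˡ-*; +-*-ring)
open import Data.Rational.Solver using (module +-*-Solver)
open import Algebra.Bundles using (Ring)
open import Algebra.Properties.Semiring.Sum (Ring.semiring +-*-ring)
  using (sum; sum-cong-≗; ∑-distrib-+; ∑-comm; *-distribˡ-sum)
open import Function using (_∘_; _⇔_; mk⇔; Equivalence)
open import Level using (0ℓ)
open import Relation.Binary.PropositionalEquality using (refl; sym; trans; cong; cong₂; module ≡-Reasoning)
open import Relation.Nullary using (Dec; yes; no; contradiction)
open import Relation.Nullary.Decidable using (_×-dec_)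
open import Relation.Unary using (Pred; Decidable)

open ≡-Reasoning
open Equivalence using (to; from)

𝟙 : ∀ {A : Set} → Dec A → ℚ
𝟙 (yes _) = 1ℚ
𝟙 (no _) = 0ℚ

𝟙-cong : ∀ {A B : Set} → A ⇔ B → (a : Dec A) (b : Dec B) → 𝟙 a ≡ 𝟙 b
𝟙-cong A⇔B (yes _) (yes _) = refl
𝟙-cong A⇔B (yes x) (no ¬y) = contradiction (to A⇔B x) ¬y
𝟙-cong A⇔B (no ¬x) (yes y) = contradiction (from A⇔B y) ¬x
𝟙-cong A⇔B (no _) (no _) = refl

𝟙-transfer : ∀ {A B C : Set} (a : Dec A) (b : Dec B) (c : Dec C) → (C → A ⇔ B) →
             ∀ q → 𝟙 a * (𝟙 c * q) ≡ 𝟙 b * (𝟙 c * q)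
𝟙-transfer a b (yes z) A⇔B q = cong (_* (1ℚ * q)) (𝟙-cong (A⇔B z) a b)
𝟙-transfer a b (no _) _ q = trans (x*[0*q]≡0 (𝟙 a)) (sym (x*[0*q]≡0 (𝟙 b)))
  where
  x*[0*q]≡0 : ∀ x → x * (0ℚ * q) ≡ 0ℚ
  x*[0*q]≡0 x = trans (cong (x *_) (*-zeroˡ q)) (*-zeroʳ x)

sumWhere≡sum-𝟙 : ∀ {n} {Q : Pred (Fin n) 0ℓ} (Q? : Decidable Q) (f : Fin n → ℚ) →
                   sumWhere Q? f ≡ sum (λ i → 𝟙 (Q? i) * f i)
sumWhere≡sum-𝟙 {ℕ.zero} Q? f = refl
sumWhere≡sum-𝟙 {ℕ.suc n} Q? f with Q? zero
... | yes _ = cong₂ _+_ (sym (*-identityˡ (f zero))) (sumWhere≡sum-𝟙 (Q? ∘ suc) (f ∘ suc))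
... | no _ = cong₂ _+_ (sym (*-zeroˡ (f zero))) (sumWhere≡sum-𝟙 (Q? ∘ suc) (f ∘ suc))

sumWhere-cong : ∀ {n} {Q : Pred (Fin n) 0ℓ} (Q? : Decidable Q) {f g : Fin n → ℚ} →
                (∀ i → Q i → f i ≡ g i) → sumWhere Q? f ≡ sumWhere Q? g
sumWhere-cong {ℕ.zero} Q? f≡g = refl
sumWhere-cong {ℕ.suc n} Q? f≡g with Q? zero
... | yes q = cong₂ _+_ (f≡g zero q) (sumWhere-cong (Q? ∘ suc) (f≡g ∘ suc))
... | no _ = cong (0ℚ +_) (sumWhere-cong (Q? ∘ suc) (f≡g ∘ suc))

sumWhere-congᵖ : ∀ {n} {Q Q′ : Pred (Fin n) 0ℓ} (Q? : Decidable Q) (Q′? : Decidable Q′) →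
                 (∀ i → Q i ⇔ Q′ i) → (f : Fin n → ℚ) → sumWhere Q? f ≡ sumWhere Q′? f
sumWhere-congᵖ Q? Q′? Q⇔Q′ f = begin
  sumWhere Q? f                ≡⟨ sumWhere≡sum-𝟙 Q? f ⟩
  sum (λ i → 𝟙 (Q? i) * f i)   ≡⟨ sum-cong-≗ (λ i → cong (_* f i) (𝟙-cong (Q⇔Q′ i) (Q? i) (Q′? i))) ⟩
  sum (λ i → 𝟙 (Q′? i) * f i)  ≡⟨ sumWhere≡sum-𝟙 Q′? f ⟨
  sumWhere Q′? f               ∎

module _ {n : ℕ} {Q : Pred (Fin n) 0ℓ} (Q? : Decidable Q) where

  sumWhere-+ : ∀ (f g : Fin n → ℚ) → sumWhere Q? (λ i → f i + g i) ≡ sumWhere Q? f + sumWhere Q? g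
  sumWhere-+ f g = begin
    sumWhere Q? (λ i → f i + g i)
      ≡⟨ sumWhere≡sum-𝟙 Q? _ ⟩
    sum (λ i → 𝟙 (Q? i) * (f i + g i))
      ≡⟨ sum-cong-≗ (λ i → *-distribˡ-+ (𝟙 (Q? i)) (f i) (g i)) ⟩
    sum (λ i → 𝟙 (Q? i) * f i + 𝟙 (Q? i) * g i)
      ≡⟨ ∑-distrib-+ {n} _ _ ⟩
    sum (λ i → 𝟙 (Q? i) * f i) + sum (λ i → 𝟙 (Q? i) * g i)
      ≡⟨ cong₂ _+_ (sumWhere≡sum-𝟙 Q? f) (sumWhere≡sum-𝟙 Q? g) ⟨
    sumWhere Q? f + sumWhere Q? g
      ∎

  sumWhere-*ˡ : ∀ c (f : Fin n → ℚ) → sumWhere Q? (λ i → c * f i) ≡ c * sumWhere Q? f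
  sumWhere-*ˡ c f = begin
    sumWhere Q? (λ i → c * f i)        ≡⟨ sumWhere≡sum-𝟙 Q? _ ⟩
    sum (λ i → 𝟙 (Q? i) * (c * f i))   ≡⟨ sum-cong-≗ (λ i → x*[c*y]≡c*[x*y] (𝟙 (Q? i)) (f i)) ⟩
    sum (λ i → c * (𝟙 (Q? i) * f i))   ≡⟨ *-distribˡ-sum {n} c _ ⟨
    c * sum (λ i → 𝟙 (Q? i) * f i)     ≡⟨ cong (c *_) (sumWhere≡sum-𝟙 Q? f) ⟨
    c * sumWhere Q? f                  ∎
    where
    x*[c*y]≡c*[x*y] : ∀ x y → x * (c * y) ≡ c * (x * y)
    x*[c*y]≡c*[x*y] x y = trans (sym (*-assoc x c y)) (trans (cong (_* y) (*-comm x c)) (*-assoc c x y))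

  sumWhere-neg : ∀ (f : Fin n → ℚ) → sumWhere Q? (λ i → - f i) ≡ - sumWhere Q? f
  sumWhere-neg f = begin
    sumWhere Q? (λ i → - f i)        ≡⟨ sumWhere-cong Q? (λ i _ → -x≡-1*x (f i)) ⟩
    sumWhere Q? (λ i → - 1ℚ * f i)   ≡⟨ sumWhere-*ˡ (- 1ℚ) f ⟩
    - 1ℚ * sumWhere Q? f             ≡⟨ -x≡-1*x (sumWhere Q? f) ⟨
    - sumWhere Q? f                  ∎
    where
    -x≡-1*x : ∀ x → - x ≡ - 1ℚ * x
    -x≡-1*x x = trans (cong -_ (sym (*-identityˡ x))) (neg-distribˡ-* 1ℚ x)

  sumWhere-const : ∀ c → sumWhere Q? (λ _ → c) ≡ c * count Q?
  sumWhere-const c = trans (sumWhere-cong Q? (λ _ _ → sym (*-identityʳ c))) (sumWhere-*ˡ c (λ _ → 1ℚ))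

  sumWhere-− : ∀ (f g : Fin n → ℚ) → sumWhere Q? (λ i → f i - g i) ≡ sumWhere Q? f - sumWhere Q? g
  sumWhere-− f g = trans (sumWhere-+ f (λ i → - g i)) (cong (sumWhere Q? f +_) (sumWhere-neg g))

  sumWhere-quadratic : ∀ c (f : Fin n → ℚ) →
    sumWhere Q? (λ i → 1ℚ + c * f i - f i * f i) ≡ count Q? + c * sumWhere Q? f - sumWhere Q? (λ i → f i * f i)
  sumWhere-quadratic c f = begin
    sumWhere Q? (λ i → 1ℚ + c * f i - f i * f i)
      ≡⟨ sumWhere-− _ _ ⟩
    sumWhere Q? (λ i → 1ℚ + c * f i) - sumWhere Q? (λ i → f i * f i)
      ≡⟨ cong (_- sumWhere Q? (λ i → f i * f i)) (sumWhere-+ _ _) ⟩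
    count Q? + sumWhere Q? (λ i → c * f i) - sumWhere Q? (λ i → f i * f i)
      ≡⟨ cong (λ t → count Q? + t - sumWhere Q? (λ i → f i * f i)) (sumWhere-*ˡ c f) ⟩
    count Q? + c * sumWhere Q? f - sumWhere Q? (λ i → f i * f i)
      ∎

sumWhere-nested : ∀ {m n} {Q : Pred (Fin m) 0ℓ} {R : Fin m → Fin n → Set}
  (Q? : Decidable Q) (R? : ∀ x y → Dec (R x y)) (h : Fin m → Fin n → ℚ) →
  sumWhere Q? (λ x → sumWhere (R? x) (h x)) ≡ sum (λ x → sum (λ y → 𝟙 (Q? x) * (𝟙 (R? x y) * h x y)))
sumWhere-nested {n = n} Q? R? h = begin
  sumWhere Q? (λ x → sumWhere (R? x) (h x))
    ≡⟨ sumWhere≡sum-𝟙 Q? _ ⟩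
  sum (λ x → 𝟙 (Q? x) * sumWhere (R? x) (h x))
    ≡⟨ sum-cong-≗ (λ x → cong (𝟙 (Q? x) *_) (sumWhere≡sum-𝟙 (R? x) (h x))) ⟩
  sum (λ x → 𝟙 (Q? x) * sum (λ y → 𝟙 (R? x y) * h x y))
    ≡⟨ sum-cong-≗ (λ x → *-distribˡ-sum {n} (𝟙 (Q? x)) _) ⟩
  sum (λ x → sum (λ y → 𝟙 (Q? x) * (𝟙 (R? x y) * h x y)))
    ∎

sumWhere-swap : ∀ {m n} {Q : Pred (Fin m) 0ℓ} {Q′ : Pred (Fin n) 0ℓ} {R : Fin m → Fin n → Set}
  (Q? : Decidable Q) (Q′? : Decidable Q′) (R? : ∀ x y → Dec (R x y)) →
  (∀ {x y} → R x y → Q x ⇔ Q′ y) → (h : Fin m → Fin n → ℚ) →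
  sumWhere Q? (λ x → sumWhere (R? x) (h x)) ≡ sumWhere Q′? (λ y → sumWhere (λ x → R? x y) (λ x → h x y))
sumWhere-swap {m} {n} Q? Q′? R? Q⇔Q′ h = begin
  sumWhere Q? (λ x → sumWhere (R? x) (h x))
    ≡⟨ sumWhere-nested Q? R? h ⟩
  sum (λ x → sum (λ y → 𝟙 (Q? x) * (𝟙 (R? x y) * h x y)))
    ≡⟨ sum-cong-≗ (λ x → sum-cong-≗ (λ y → 𝟙-transfer (Q? x) (Q′? y) (R? x y) Q⇔Q′ (h x y))) ⟩
  sum (λ x → sum (λ y → 𝟙 (Q′? y) * (𝟙 (R? x y) * h x y)))
    ≡⟨ ∑-comm {m} {n} _ ⟩
  sum (λ y → sum (λ x → 𝟙 (Q′? y) * (𝟙 (R? x y) * h x y)))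
    ≡⟨ sumWhere-nested Q′? (λ y x → R? x y) (λ y x → h x y) ⟨
  sumWhere Q′? (λ y → sumWhere (λ x → R? x y) (λ x → h x y))
    ∎

module LevelSums {n : ℕ} (P : FinPoset n) (ρ : Fin n → ℕ)
                 (ρ-cover : ∀ a b → _⋖_ P a b → ρ b ≡ ℕ.suc (ρ a)) where
  open Ranked P ρ

  onLevel? : ∀ i → Decidable (λ x → ρ x ≡ i)
  onLevel? i x = ρ x ℕ.≟ i

  levelSum : ℕ → (Fin n → ℚ) → ℚ
  levelSum i = sumWhere (onLevel? i)

  upDegree : Fin n → ℚ
  upDegree x = count (λ y → _⋖?_ P x y)

  downDegree : Fin n → ℚ
  downDegree y = count (λ x → _⋖?_ P x y)

  levelSum-swap-covers : ∀ i (h : Fin n → Fin n → ℚ) →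
    levelSum i (λ x → sumWhere (λ y → _⋖?_ P x y) (h x)) ≡
    levelSum (ℕ.suc i) (λ y → sumWhere (λ x → _⋖?_ P x y) (λ x → h x y))
  levelSum-swap-covers i = sumWhere-swap (onLevel? i) (onLevel? (ℕ.suc i)) (_⋖?_ P) rank-step
    where
    rank-step : ∀ {x y} → _⋖_ P x y → (ρ x ≡ i) ⇔ (ρ y ≡ ℕ.suc i)
    rank-step {x} {y} x⋖y = mk⇔ (λ ρx≡i → trans (ρ-cover x y x⋖y) (cong ℕ.suc ρx≡i))
                                (λ ρy≡1+i → suc-injective (trans (sym (ρ-cover x y x⋖y)) ρy≡1+i))

  A≡upDegree : ∀ {i x} → ρ x ≡ i → A i x ≡ upDegree x
  A≡upDegree {i} {x} ρx≡i =
    sumWhere-congᵖ (λ y → (ρ y ℕ.≟ ℕ.suc i) ×-dec _⋖?_ P x y) (λ y → _⋖?_ P x y) x⋖y⇔ (λ _ → 1ℚ)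
    where
    x⋖y⇔ : ∀ y → (ρ y ≡ ℕ.suc i × _⋖_ P x y) ⇔ _⋖_ P x y
    x⋖y⇔ y = mk⇔ proj₂ (λ x⋖y → trans (ρ-cover x y x⋖y) (cong ℕ.suc ρx≡i) , x⋖y)

  B≡downDegree : ∀ {i y} → ρ y ≡ ℕ.suc i → B (ℕ.suc i) y ≡ downDegree y
  B≡downDegree {i} {y} ρy≡1+i =
    sumWhere-congᵖ (λ x → (ℕ.suc (ρ x) ℕ.≟ ℕ.suc i) ×-dec _⋖?_ P x y) (λ x → _⋖?_ P x y) x⋖y⇔ (λ _ → 1ℚ)
    where
    x⋖y⇔ : ∀ x → (ℕ.suc (ρ x) ≡ ℕ.suc i × _⋖_ P x y) ⇔ _⋖_ P x y
    x⋖y⇔ x = mk⇔ proj₂ (λ x⋖y → trans (sym (ρ-cover x y x⋖y)) ρy≡1+i , x⋖y)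

  levelSum-A≡levelSum-B : ∀ i → levelSum i (A i) ≡ levelSum (ℕ.suc i) (B (ℕ.suc i))
  levelSum-A≡levelSum-B i = begin
    levelSum i (A i)                   ≡⟨ sumWhere-cong (onLevel? i) (λ _ → A≡upDegree) ⟩
    levelSum i upDegree                ≡⟨ levelSum-swap-covers i (λ _ _ → 1ℚ) ⟩
    levelSum (ℕ.suc i) downDegree      ≡⟨ sumWhere-cong (onLevel? (ℕ.suc i)) (λ _ → B≡downDegree) ⟨
    levelSum (ℕ.suc i) (B (ℕ.suc i))   ∎

  levelSum-D≡levelSum-A² : ∀ i → levelSum (ℕ.suc i) (D (ℕ.suc i)) ≡ levelSum i (λ x → A i x * A i x)
  levelSum-D≡levelSum-A² i = begin
    levelSum (ℕ.suc i) (D (ℕ.suc i))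
      ≡⟨ levelSum-swap-covers i (λ x _ → A i x) ⟨
    levelSum i (λ x → sumWhere (λ y → _⋖?_ P x y) (λ _ → A i x))
      ≡⟨ sumWhere-cong (onLevel? i) (λ x ρx≡i →
           trans (sumWhere-const (λ y → _⋖?_ P x y) (A i x)) (cong (A i x *_) (sym (A≡upDegree ρx≡i)))) ⟩
    levelSum i (λ x → A i x * A i x)
      ∎

  levelSum-U≡levelSum-B² : ∀ i → levelSum i (U i) ≡ levelSum (ℕ.suc i) (λ y → B (ℕ.suc i) y * B (ℕ.suc i) y)
  levelSum-U≡levelSum-B² i = begin
    levelSum i (U i)
      ≡⟨ levelSum-swap-covers i (λ _ y → B (ℕ.suc i) y) ⟩
    levelSum (ℕ.suc i) (λ y → sumWhere (λ x → _⋖?_ P x y) (λ _ → B (ℕ.suc i) y))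
      ≡⟨ sumWhere-cong (onLevel? (ℕ.suc i)) (λ y ρy≡1+i →
           trans (sumWhere-const (λ x → _⋖?_ P x y) (B (ℕ.suc i) y)) (cong (B (ℕ.suc i) y *_) (sym (B≡downDegree ρy≡1+i)))) ⟩
    levelSum (ℕ.suc i) (λ y → B (ℕ.suc i) y * B (ℕ.suc i) y)
      ∎

  levelSum-R₁ : levelSum 1 R₁ ≡
    p 1 + ℕtoℚ 6 * levelSum 1 (A 1) + 3/2 * levelSum 1 (B 1) - levelSum 1 (U 1) - levelSum 1 (D 1)
  levelSum-R₁ = begin
    levelSum 1 R₁
      ≡⟨ sumWhere-− (onLevel? 1) _ _ ⟩
    levelSum 1 (λ e → 1ℚ + ℕtoℚ 6 * A 1 e + 3/2 * B 1 e - U 1 e) - L D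
      ≡⟨ cong (_- L D) (sumWhere-− (onLevel? 1) _ _) ⟩
    levelSum 1 (λ e → 1ℚ + ℕtoℚ 6 * A 1 e + 3/2 * B 1 e) - L U - L D
      ≡⟨ cong (λ t → t - L U - L D) (sumWhere-+ (onLevel? 1) _ _) ⟩
    levelSum 1 (λ e → 1ℚ + ℕtoℚ 6 * A 1 e) + levelSum 1 (λ e → 3/2 * B 1 e) - L U - L D
      ≡⟨ cong (λ t → t + levelSum 1 (λ e → 3/2 * B 1 e) - L U - L D) (sumWhere-+ (onLevel? 1) _ _) ⟩
    p 1 + levelSum 1 (λ e → ℕtoℚ 6 * A 1 e) + levelSum 1 (λ e → 3/2 * B 1 e) - L U - L D
      ≡⟨ cong₂ (λ s t → p 1 + s + t - L U - L D)
               (sumWhere-*ˡ (onLevel? 1) (ℕtoℚ 6) (A 1)) (sumWhere-*ˡ (onLevel? 1) 3/2 (B 1)) ⟩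
    p 1 + ℕtoℚ 6 * L A + 3/2 * L B - L U - L D
      ∎
    where
    L : (ℕ → Fin n → ℚ) → ℚ
    L F = levelSum 1 (F 1)

cross-terms-cancel : ∀ p₀ p₁ p₂ a b {x x′ y y′ s s′ t t′ : ℚ} → x′ ≡ x → y′ ≡ y → s′ ≡ s → t′ ≡ t →
  (p₀ + a * x - s) - (p₁ + b * y + a * x′ - t′ - s′) + (p₂ + b * y′ - t) ≡ p₀ + - p₁ + - (- p₂)
cross-terms-cancel p₀ p₁ p₂ a b {x} {_} {y} {_} {s} {_} {t} refl refl refl refl =
  solve 9 (λ p₀ p₁ p₂ a b x y s t →
             (p₀ :+ a :* x :- s) :- (p₁ :+ b :* y :+ a :* x :- t :- s) :+ (p₂ :+ b :* y :- t)
             := p₀ :+ :- p₁ :+ :- (:- p₂))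
          refl p₀ p₁ p₂ a b x y s t
  where open +-*-Solver

theorem2p4 : (n : ℕ) (P : FinPoset n) (ρ : Fin n → ℕ) → IsRankFunction P ρ → HasRank P ρ 2 → Ranked.LHS P ρ ≡ Ranked.χgr P ρ 2
theorem2p4 n P ρ isRank _ = begin
  LHS
    ≡⟨ cong₂ _+_ (cong₂ _-_ (sumWhere-quadratic (onLevel? 0) 3/2 (A 0)) levelSum-R₁)
                 (sumWhere-quadratic (onLevel? 2) (ℕtoℚ 6) (B 2)) ⟩
  (p 0 + 3/2 * levelSum 0 (A 0) - levelSum 0 (λ v → A 0 v * A 0 v))
    - (p 1 + ℕtoℚ 6 * levelSum 1 (A 1) + 3/2 * levelSum 1 (B 1) - levelSum 1 (U 1) - levelSum 1 (D 1))
    + (p 2 + ℕtoℚ 6 * levelSum 2 (B 2) - levelSum 2 (λ σ → B 2 σ * B 2 σ))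
    ≡⟨ cross-terms-cancel (p 0) (p 1) (p 2) 3/2 (ℕtoℚ 6)
         (sym (levelSum-A≡levelSum-B 0)) (sym (levelSum-A≡levelSum-B 1))
         (levelSum-D≡levelSum-A² 0) (levelSum-U≡levelSum-B² 1) ⟩
  χgr 2
    ∎
  where
  open Ranked P ρ
  open LevelSums P ρ (IsRankFunction.cover⇒suc isRank)
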